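{- Let $G$ be a connected graph with $n(G)\ge 2$ and let $T$ be a tree with $n(T)\ge 3$. Then ${\rm gp}_{\rm S}(G,T)=n(G)\,\ell(T)$, where $\ell(T)$ is the number of leaves of $T$.
   Context: All graphs are finite, simple and connected; $n(G)=|V(G)|$. A set $X$ of vertices is a general position set if no shortest path contains more than two vertices of $X$; ${\rm gp}$ denotes the maximum cardinality of a general position set. For $f\colon V(G)\to V(H)$, the Sierpiński product $G\otimes_f H$ has vertex set $V(G)\times V(H)$ and edges $(g,h)(g,h')$ for $g\in V(G)$, $hh'\in E(H)$, and $(g,f(g'))(g',f(g))$ for $gg'\in E(G)$. ${\rm gp}_{\rm S}(G,H)=\max_{f}{\rm gp}(G\otimes_f H)$ over all functions $f\colon V(G)\to V(H)$. -}

module Defs where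

open import Data.Bool using (Bool; true; false; T; _∧_; _∨_)
open import Data.Nat using (ℕ; zero; suc; _≤_; _*_; _≡ᵇ_)
open import Data.Fin using (Fin)
open import Data.Fin.Properties using (_≟_)
open import Data.List using (List; []; _∷_; length; filterᵇ; allFin)
open import Data.List.Membership.Propositional using (_∈_)
open import Data.List.Relation.Unary.Unique.Propositional using (Unique)
open import Data.Product using (Σ; ∃; _×_; _,_)
open import Relation.Binary.PropositionalEquality using (_≡_; _≢_)
open import Relation.Nullary.Decidable using (⌊_⌋)
open import Data.Empty using (⊥)

Adjacency : Set → Set
Adjacency V = V → V → Bool

-- A finite simple graph on vertex set Fin n (so n(G) = n).
record Graph (n : ℕ) : Set where
  field
    adj    : Adjacency (Fin n)
    sym    : ∀ u v → adj u v ≡ adj v u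
    irrefl : ∀ v → adj v v ≡ false
open Graph public

data Walk {V : Set} (A : Adjacency V) : V → V → ℕ → Set where
  []  : ∀ {u} → Walk A u u 0
  _∷_ : ∀ {u w v k} → T (A u w) → Walk A w v k → Walk A u v (suc k)

verts : ∀ {V : Set} {A : Adjacency V} {u v k} → Walk A u v k → List V
verts {u = u} []      = u ∷ []
verts {u = u} (e ∷ p) = u ∷ verts p

tailVerts : ∀ {V : Set} {A : Adjacency V} {u v k} → Walk A u v k → List V
tailVerts []                = []
tailVerts (_∷_ {w = w} e p) = w ∷ tailVerts p

Connected : ∀ {V : Set} → Adjacency V → Set
Connected {V} A = ∀ (u v : V) → ∃ λ k → Walk A u v k

HasCycle : ∀ {V : Set} → Adjacency V → Set
HasCycle {V} A = Σ V λ u → Σ ℕ λ k → Σ (Walk A u u k) λ p → (3 ≤ k) × Unique (tailVerts p)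

IsTree : ∀ {n} → Graph n → Set
IsTree G = Connected (adj G) × (HasCycle (adj G) → ⊥)

IsShortest : ∀ {V : Set} {A : Adjacency V} {u v k} → Walk A u v k → Set
IsShortest {A = A} {u} {v} {k} p = ∀ {m} → Walk A u v m → k ≤ m

GeneralPosition : ∀ {V : Set} → Adjacency V → List V → Set
GeneralPosition {V} A X =
  ∀ {u v k} (p : Walk A u v k) → IsShortest p →
  ∀ (x y z : V) → x ∈ X → y ∈ X → z ∈ X → x ≢ y → y ≢ z → x ≢ z →
  x ∈ verts p → y ∈ verts p → z ∈ verts p → ⊥

IsGPSet : ∀ {V : Set} → Adjacency V → List V → Set
IsGPSet A X = Unique X × GeneralPosition A X

IsGP : ∀ {V : Set} → Adjacency V → ℕ → Set
IsGP {V} A k = (Σ (List V) λ X → IsGPSet A X × length X ≡ k)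
             × (∀ X → IsGPSet A X → length X ≤ k)

sierpinski : ∀ {n m} → Graph n → (Fin n → Fin m) → Graph m → Adjacency (Fin n × Fin m)
sierpinski G f H (g , h) (g' , h') =
  (⌊ g ≟ g' ⌋ ∧ adj H h h')
  ∨ (adj G g g' ∧ (⌊ h ≟ f g' ⌋ ∧ ⌊ h' ≟ f g ⌋))

IsGPS : ∀ {n m} → Graph n → Graph m → ℕ → Set
IsGPS {n} {m} G H k =
  (Σ (Fin n → Fin m) λ f → IsGP (sierpinski G f H) k)
  × (∀ (f : Fin n → Fin m) j → IsGP (sierpinski G f H) j → j ≤ k)

degree : ∀ {n} → Graph n → Fin n → ℕ
degree {n} G v = length (filterᵇ (adj G v) (allFin n))

numLeaves : ∀ {n} → Graph n → ℕ
numLeaves {n} G = length (filterᵇ (λ v → degree G v ≡ᵇ 1) (allFin n))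

-- Projecting a walk of G ⊗_f T between two vertices of a layer {g} × V(T) gives a
-- walk in T that is no longer, so every layer of a general position set X is a general position
-- set of T. In a tree T, each s of a general position set S has a leaf l such that every walk from
-- l to S ∖ {s} passes through s: if s is not a leaf it has two sides, and they cannot both reach
-- S ∖ {s} avoiding s, for then a shortest path between two vertices of S ∖ {s} would contain s.
-- Distinct s get distinct leaves, so each layer has at most ℓ(T) vertices and |X| ≤ n(G) ℓ(T).
--
-- If f takes only non-leaf values, a vertex (g, l) with l a leaf of T has exactly
-- one neighbour, so it is an end of every shortest path through it; hence V(G) × leaves(T) is a
-- general position set of size n(G) ℓ(T).

module Submission where

open import Defs renaming (sym to adj-sym)
open import Data.Bool using (Bool; T; _∧_; _∨_)
open import Data.Bool.Properties using (T-∧; T-∨; ∧-comm)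
open import Data.Empty using (⊥; ⊥-elim)
open import Data.Fin using (Fin; fromℕ<)
open import Data.Fin.Properties using (_≟_; any?; injective⇒≤)
open import Data.List
  using (List; []; _∷_; length; lookup; filter; filterᵇ; allFin; map; concatMap; cartesianProduct)
open import Data.List.Properties using (length-++; length-map; length-tabulate)
open import Data.List.Membership.Propositional using (_∈_; _∉_; lose)
open import Data.List.Membership.Propositional.Properties
  using (∈-filter⁺; ∈-filter⁻; ∈-allFin; ∈-lookup; ∈-map⁺; ∈-concatMap⁺; ∈-cartesianProduct⁻)
open import Data.List.Membership.Setoid.Properties using (index-injective)
open import Data.List.Relation.Binary.Disjoint.Propositional using (Disjoint)
open import Data.List.Relation.Binary.Subset.Propositional using (_⊆_)
open import Data.List.Relation.Unary.All as All using (All; []; _∷_; sequenceM)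
open import Data.List.Relation.Unary.All.Properties using (¬Any⇒All¬)
open import Data.List.Relation.Unary.Any as Any using (here; there)
open import Data.List.Relation.Unary.Unique.Propositional using (Unique; []; _∷_)
import Data.List.Relation.Unary.Unique.Propositional.Properties as Unique
open import Data.Nat using (ℕ; zero; suc; _+_; _*_; _≤_; _<_; _≤?_; _≡ᵇ_; z≤n; s≤s)
open import Data.Nat.Induction using (<-rec)
open import Data.Nat.Properties
  using (≤-trans; ≤-antisym; <⇒≱; ≮⇒≥; ≤-<-trans; <-irrefl; n<1+n; m<n⇒m<1+n; m≤n⇒m≤1+n;
         m≤m+n; +-suc; +-comm; +-mono-≤; n≤1+n; module ≤-Reasoning)
import Data.Nat.Properties as ℕ
open import Data.Product using (∃; ∃₂; _×_; _,_; proj₁; proj₂)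
open import Data.Product.Properties using (≡-dec)
open import Data.Sum using (_⊎_; inj₁; inj₂; [_,_]; swap) renaming (map to ⊎-map)
open import Function using (_∘_; id; const)
open import Function.Bundles using (Equivalence)
open import Function.Definitions using (Injective)
open import Level using (0ℓ)
open import Relation.Binary.Definitions using (DecidableEquality)
open import Relation.Binary.PropositionalEquality
  using (_≡_; _≢_; refl; sym; trans; cong; cong₂; subst; setoid)
open import Relation.Nullary using (¬_; yes; no)
open import Relation.Nullary.Decidable
  using (⌊_⌋; toWitness; fromWitness; decidable-stable; ¬?; _×-dec_; T?)
open import Relation.Nullary.Negation using (¬¬-Monad; ¬¬-map; contradiction)

module _ {A : Set} where

  lookup-injective : {xs : List A} → Unique xs → Injective _≡_ _≡_ (lookup xs)
  lookup-injective (_ ∷ _)         {Fin.zero}  {Fin.zero}  _  = refl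
  lookup-injective (x∉xs ∷ _)      {Fin.zero}  {Fin.suc j} eq = contradiction eq (All.lookup x∉xs (∈-lookup j))
  lookup-injective (x∉xs ∷ _)      {Fin.suc i} {Fin.zero}  eq = contradiction (sym eq) (All.lookup x∉xs (∈-lookup i))
  lookup-injective (_ ∷ xs-unique) {Fin.suc i} {Fin.suc j} eq = cong Fin.suc (lookup-injective xs-unique eq)

module _ {A B : Set} where

  injection⇒length≤ : {xs : List A} {ys : List B} (R : A → B → Set) → Unique xs →
    All (λ x → ∃ λ y → y ∈ ys × R x y) xs →
    (∀ {x x′ y} → x ∈ xs → x′ ∈ xs → R x y → R x′ y → x ≡ x′) →
    length xs ≤ length ys
  injection⇒length≤ {xs} {ys} R xs-unique image R-injective = injective⇒≤ position-injective
    where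
      image-of : ∀ i → ∃ λ y → y ∈ ys × R (lookup xs i) y
      image-of i = All.lookup image (∈-lookup i)

      position : Fin (length xs) → Fin (length ys)
      position i = Any.index (proj₁ (proj₂ (image-of i)))

      position-injective : Injective _≡_ _≡_ position
      position-injective {i} {j} eq =
        let y , y∈ys , Ry = image-of i
            y′ , y′∈ys , Ry′ = image-of j
            y′≡y = sym (index-injective (setoid B) y∈ys y′∈ys eq)
        in lookup-injective xs-unique
             (R-injective (∈-lookup i) (∈-lookup j) Ry (subst (R _) y′≡y Ry′))

  length-cartesianProduct : (xs : List A) (ys : List B) →
    length (cartesianProduct xs ys) ≡ length xs * length ys
  length-cartesianProduct []       ys = refl
  length-cartesianProduct (x ∷ xs) ys =
    trans (length-++ (map (x ,_) ys))
          (cong₂ _+_ (length-map (x ,_) ys) (length-cartesianProduct xs ys))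

  length-concatMap≤ : (f : A → List B) (xs : List A) {k : ℕ} →
    (∀ x → length (f x) ≤ k) → length (concatMap f xs) ≤ length xs * k
  length-concatMap≤ f []       _     = z≤n
  length-concatMap≤ f (x ∷ xs) bound =
    subst (_≤ _) (sym (length-++ (f x))) (+-mono-≤ (bound x) (length-concatMap≤ f xs bound))

module _ {A : Set} where

  ⊆⇒length≤ : {xs ys : List A} → Unique xs → xs ⊆ ys → length xs ≤ length ys
  ⊆⇒length≤ xs-unique xs⊆ys =
    injection⇒length≤ _≡_ xs-unique (All.tabulate (λ x∈xs → _ , xs⊆ys x∈xs , refl))
      (λ _ _ x≡y x′≡y → trans x≡y (sym x′≡y))

  ¬three-distinct-in-pair : {u v x y z : A} → x ≡ u ⊎ x ≡ v → y ≡ u ⊎ y ≡ v → z ≡ u ⊎ z ≡ v →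
    x ≢ y → y ≢ z → x ≢ z → ⊥
  ¬three-distinct-in-pair (inj₁ refl) (inj₁ refl) _           x≢y _   _   = x≢y refl
  ¬three-distinct-in-pair (inj₂ refl) (inj₂ refl) _           x≢y _   _   = x≢y refl
  ¬three-distinct-in-pair (inj₁ refl) (inj₂ refl) (inj₁ refl) _   _   x≢z = x≢z refl
  ¬three-distinct-in-pair (inj₁ refl) (inj₂ refl) (inj₂ refl) _   y≢z _   = y≢z refl
  ¬three-distinct-in-pair (inj₂ refl) (inj₁ refl) (inj₁ refl) _   y≢z _   = y≢z refl
  ¬three-distinct-in-pair (inj₂ refl) (inj₁ refl) (inj₂ refl) _   _   x≢z = x≢z refl

⌊≟⌋-sym : ∀ {A : Set} (_≟ₐ_ : DecidableEquality A) (x y : A) → ⌊ x ≟ₐ y ⌋ ≡ ⌊ y ≟ₐ x ⌋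
⌊≟⌋-sym _≟ₐ_ x y with x ≟ₐ y | y ≟ₐ x
... | yes _   | yes _   = refl
... | no _    | no _    = refl
... | yes x≡y | no y≢x  = contradiction (sym x≡y) y≢x
... | no x≢y  | yes y≡x = contradiction (sym y≡x) x≢y

length-allFin : ∀ m → length (allFin m) ≡ m
length-allFin m = length-tabulate id

Unique⇒length≤ : ∀ {m} {xs : List (Fin m)} → Unique xs → length xs ≤ m
Unique⇒length≤ {m} {xs} xs-unique =
  subst (length xs ≤_) (length-allFin m) (⊆⇒length≤ xs-unique (λ {x} _ → ∈-allFin x))

missing-element : ∀ {m} (xs : List (Fin m)) → length xs < m → ∃ λ c → c ∉ xs
missing-element {m} xs short with any? (λ c → ¬? (Any.any? (c ≟_) xs))
... | yes found = found
... | no none   =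
  contradiction (subst (_≤ length xs) (length-allFin m) (⊆⇒length≤ (Unique.allFin⁺ m) covered)) (<⇒≱ short)
  where
    covered : allFin m ⊆ xs
    covered {c} _ = decidable-stable (Any.any? (c ≟_) xs) (λ c∉xs → none (c , c∉xs))

AtMostOneNeighbour : ∀ {V : Set} → Adjacency V → V → Set
AtMostOneNeighbour A x = ∀ {a b} → T (A x a) → T (A x b) → a ≡ b

module _ {V : Set} {A : Adjacency V} where

  source∈verts : ∀ {u v k} (p : Walk A u v k) → u ∈ verts p
  source∈verts []      = here refl
  source∈verts (_ ∷ _) = here refl

  target∈verts : ∀ {u v k} (p : Walk A u v k) → v ∈ verts p
  target∈verts []      = here refl
  target∈verts (_ ∷ p) = there (target∈verts p)

  verts≡source∷tailVerts : ∀ {u v k} (p : Walk A u v k) → verts p ≡ u ∷ tailVerts p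
  verts≡source∷tailVerts []      = refl
  verts≡source∷tailVerts (_ ∷ p) = cong (_ ∷_) (verts≡source∷tailVerts p)

  walk-length-pos : ∀ {u v k} → u ≢ v → Walk A u v k → 0 < k
  walk-length-pos u≢v []      = contradiction refl u≢v
  walk-length-pos _   (_ ∷ _) = s≤s z≤n

  walk-preserves : (P : V → Set) → (∀ {x y} → T (A x y) → P x → P y) →
    ∀ {u v k} → Walk A u v k → P u → P v
  walk-preserves P step []      Pu = Pu
  walk-preserves P step (e ∷ p) Pu = walk-preserves P step p (step e Pu)

  infixr 5 _++ᵂ_
  _++ᵂ_ : ∀ {u v w j k} → Walk A u v j → Walk A v w k → Walk A u w (j + k)
  []      ++ᵂ q = q
  (e ∷ p) ++ᵂ q = e ∷ (p ++ᵂ q)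

  ∈-verts-++⁻ : ∀ {u v w j k x} (p : Walk A u v j) (q : Walk A v w k) →
    x ∈ verts (p ++ᵂ q) → x ∈ verts p ⊎ x ∈ verts q
  ∈-verts-++⁻ []      q x∈q              = inj₂ x∈q
  ∈-verts-++⁻ (_ ∷ p) q (here refl)      = inj₁ (here refl)
  ∈-verts-++⁻ (_ ∷ p) q (there x∈p++q)   = ⊎-map there id (∈-verts-++⁻ p q x∈p++q)

  ∉-verts-++ : ∀ {u v w j k x} (p : Walk A u v j) (q : Walk A v w k) →
    x ∉ verts p → x ∉ verts q → x ∉ verts (p ++ᵂ q)
  ∉-verts-++ p q x∉p x∉q = [ x∉p , x∉q ] ∘ ∈-verts-++⁻ p q

  prefix : ∀ {u v k x} (p : Walk A u v k) → x ∈ verts p →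
    ∃₂ λ j (q : Walk A u x j) → verts q ⊆ verts p × j ≤ k × (x ≢ v → j < k)
  prefix []      (here refl) = 0 , [] , id , z≤n , λ x≢v → contradiction refl x≢v
  prefix (_ ∷ _) (here refl) = 0 , [] , (λ { (here refl) → here refl }) , z≤n , λ _ → s≤s z≤n
  prefix (e ∷ p) (there x∈p) =
    let j , q , q⊆p , j≤k , j<k = prefix p x∈p
    in suc j , e ∷ q , (λ { (here refl) → here refl ; (there y∈q) → there (q⊆p y∈q) }) , s≤s j≤k , s≤s ∘ j<k

  suffix : ∀ {u v k x} (p : Walk A u v k) → Unique (verts p) → x ∈ verts p →
    ∃₂ λ j (q : Walk A x v j) → Unique (verts q) × verts q ⊆ verts p
  suffix []      p-unique (here refl)     = 0 , [] , p-unique , id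
  suffix (e ∷ p) p-unique (here refl)     = _ , e ∷ p , p-unique , id
  suffix (e ∷ p) (_ ∷ p-unique) (there x∈p) =
    let j , q , q-unique , q⊆p = suffix p p-unique x∈p in j , q , q-unique , there ∘ q⊆p

  to-path : DecidableEquality V → ∀ {u v k} (p : Walk A u v k) →
    ∃₂ λ j (q : Walk A u v j) → Unique (verts q) × verts q ⊆ verts p
  to-path _≟ᵥ_ [] = 0 , [] , [] ∷ [] , id
  to-path _≟ᵥ_ {u} (e ∷ p) with to-path _≟ᵥ_ p
  ... | j , q , q-unique , q⊆p with Any.any? (u ≟ᵥ_) (verts q)
  ...   | yes u∈q =
          let i , r , r-unique , r⊆q = suffix q q-unique u∈q in i , r , r-unique , there ∘ q⊆p ∘ r⊆q
  ...   | no u∉q =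
          suc j , e ∷ q , ¬Any⇒All¬ (verts q) u∉q ∷ q-unique ,
          λ { (here refl) → here refl ; (there x∈q) → there (q⊆p x∈q) }

  ShortestWalk : V → V → Set
  ShortestWalk u v = ∃₂ λ k (p : Walk A u v k) → IsShortest p

  ¬¬shortest-walk : ∀ {u v k} → Walk A u v k → ¬ ¬ ShortestWalk u v
  ¬¬shortest-walk {u} {v} {k} = <-rec (λ k → Walk A u v k → ¬ ¬ ShortestWalk u v) step k
    where
      step : ∀ k → (∀ {j} → j < k → Walk A u v j → ¬ ¬ ShortestWalk u v) →
        Walk A u v k → ¬ ¬ ShortestWalk u v
      step k shorter p none = none (k , p , λ q → ≮⇒≥ (λ j<k → shorter j<k q none))

module Undirected {V : Set} {A : Adjacency V} (A-sym : ∀ u v → A u v ≡ A v u) where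

  flip-edge : ∀ {u v} → T (A u v) → T (A v u)
  flip-edge {u} {v} = subst T (A-sym u v)

  snoc : ∀ {u v w k} → Walk A u v k → T (A v w) → Walk A u w (suc k)
  snoc []      e = e ∷ []
  snoc (e′ ∷ p) e = e′ ∷ snoc p e

  ∈-verts-snoc⁻ : ∀ {u v w k x} (p : Walk A u v k) (e : T (A v w)) →
    x ∈ verts (snoc p e) → x ∈ verts p ⊎ x ≡ w
  ∈-verts-snoc⁻ []      e (here refl)         = inj₁ (here refl)
  ∈-verts-snoc⁻ []      e (there (here refl)) = inj₂ refl
  ∈-verts-snoc⁻ (_ ∷ p) e (here refl)         = inj₁ (here refl)
  ∈-verts-snoc⁻ (_ ∷ p) e (there x∈p)         = ⊎-map there id (∈-verts-snoc⁻ p e x∈p)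

  reverse : ∀ {u v k} → Walk A u v k → Walk A v u k
  reverse []      = []
  reverse (e ∷ p) = snoc (reverse p) (flip-edge e)

  ∈-verts-reverse⁻ : ∀ {u v k x} (p : Walk A u v k) → x ∈ verts (reverse p) → x ∈ verts p
  ∈-verts-reverse⁻ []      x∈p = x∈p
  ∈-verts-reverse⁻ (e ∷ p) x∈p with ∈-verts-snoc⁻ (reverse p) (flip-edge e) x∈p
  ... | inj₁ x∈p′ = there (∈-verts-reverse⁻ p x∈p′)
  ... | inj₂ refl = here refl

  module _ (_≟ᵥ_ : DecidableEquality V) where

    shortcut : ∀ {u v k x} (p : Walk A u v k) → x ∈ verts p → x ≢ u → x ≢ v →
      AtMostOneNeighbour A x → ∃ λ j → Walk A u v j × j < k
    shortcut []      (here refl) x≢u _ _ = contradiction refl x≢u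
    shortcut (_ ∷ _) (here refl) x≢u _ _ = contradiction refl x≢u
    shortcut {x = x} (_∷_ {w = y} e p) (there x∈p) x≢u x≢v lone with x ≟ᵥ y
    ... | no x≢y = let j , q , j<k = shortcut p x∈p x≢y x≢v lone in suc j , e ∷ q , s≤s j<k
    shortcut (e ∷ []) (there _) _ x≢v _ | yes refl = contradiction refl x≢v
    -- x is the second vertex, and its only neighbour is both u and the third vertex z.
    shortcut {u} (e ∷ (_∷_ {w = z} e′ p)) (there _) _ _ lone | yes refl with lone {u} {z} (flip-edge e) e′
    ... | refl = _ , p , m<n⇒m<1+n (n<1+n _)

    endpoint-of-shortest : ∀ {u v k x} (p : Walk A u v k) → IsShortest p → x ∈ verts p →
      AtMostOneNeighbour A x → x ≡ u ⊎ x ≡ v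
    endpoint-of-shortest {u} {v} {x = x} p p-shortest x∈p lone with x ≟ᵥ u | x ≟ᵥ v
    ... | yes x≡u | _       = inj₁ x≡u
    ... | no _    | yes x≡v = inj₂ x≡v
    ... | no x≢u  | no x≢v  =
          let _ , q , j<k = shortcut p x∈p x≢u x≢v lone in contradiction (p-shortest q) (<⇒≱ j<k)

    atMostOneNeighbour⇒generalPosition : ∀ {X} → (∀ {x} → x ∈ X → AtMostOneNeighbour A x) →
      GeneralPosition A X
    atMostOneNeighbour⇒generalPosition {X} lone {u} {v} p p-shortest
                                       x y z x∈X y∈X z∈X x≢y y≢z x≢z x∈p y∈p z∈p =
      ¬three-distinct-in-pair (endpoint x∈X x∈p) (endpoint y∈X y∈p) (endpoint z∈X z∈p) x≢y y≢z x≢z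
      where
        endpoint : ∀ {w} → w ∈ X → w ∈ verts p → w ≡ u ⊎ w ≡ v
        endpoint w∈X w∈p = endpoint-of-shortest p p-shortest w∈p (lone w∈X)

module _ {m} (G : Graph m) where

  open Undirected (adj-sym G)

  neighbours : Fin m → List (Fin m)
  neighbours v = filterᵇ (adj G v) (allFin m)

  ∈-neighbours⁺ : ∀ {v a} → T (adj G v a) → a ∈ neighbours v
  ∈-neighbours⁺ {v} {a} = ∈-filter⁺ (T? ∘ adj G v) (∈-allFin a)

  ∈-neighbours⁻ : ∀ {v a} → a ∈ neighbours v → T (adj G v a)
  ∈-neighbours⁻ {v} = proj₂ ∘ ∈-filter⁻ (T? ∘ adj G v) {xs = allFin m}

  neighbours-unique : ∀ v → Unique (neighbours v)
  neighbours-unique v = Unique.filter⁺ (T? ∘ adj G v) (Unique.allFin⁺ m)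

  isLeaf : Fin m → Bool
  isLeaf v = degree G v ≡ᵇ 1

  leaves : List (Fin m)
  leaves = filterᵇ isLeaf (allFin m)

  ∈-leaves⁺ : ∀ {v} → degree G v ≡ 1 → v ∈ leaves
  ∈-leaves⁺ {v} leaf = ∈-filter⁺ (T? ∘ isLeaf) (∈-allFin v) (ℕ.≡⇒≡ᵇ _ _ leaf)

  ∈-leaves⁻ : ∀ {v} → v ∈ leaves → degree G v ≡ 1
  ∈-leaves⁻ v∈leaves = ℕ.≡ᵇ⇒≡ _ _ (proj₂ (∈-filter⁻ (T? ∘ isLeaf) {xs = allFin m} v∈leaves))

  leaves-unique : Unique leaves
  leaves-unique = Unique.filter⁺ (T? ∘ isLeaf) (Unique.allFin⁺ m)

  no-loop : ∀ {v} → ¬ T (adj G v v)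
  no-loop {v} = subst T (irrefl G v)

  degree≡1⇒atMostOneNeighbour : ∀ {v} → degree G v ≡ 1 → AtMostOneNeighbour (adj G) v
  degree≡1⇒atMostOneNeighbour {v} leaf {a} {b} ea eb with a ≟ b
  ... | yes a≡b = a≡b
  ... | no a≢b  =
    contradiction (subst (2 ≤_) leaf (⊆⇒length≤ ((a≢b ∷ []) ∷ [] ∷ []) pair⊆)) λ { (s≤s ()) }
    where
      pair⊆ : a ∷ b ∷ [] ⊆ neighbours v
      pair⊆ (here refl)         = ∈-neighbours⁺ ea
      pair⊆ (there (here refl)) = ∈-neighbours⁺ eb

  another-neighbour : ∀ {v a} → T (adj G v a) → degree G v ≢ 1 → ∃ λ b → b ≢ a × T (adj G v b)
  another-neighbour {v} {a} e non-leaf with any? (λ b → ¬? (b ≟ a) ×-dec T? (adj G v b))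
  ... | yes found = found
  ... | no none   =
    contradiction (≤-antisym (⊆⇒length≤ (neighbours-unique v) only-a) (⊆⇒length≤ ([] ∷ []) a∈)) non-leaf
    where
      only-a : neighbours v ⊆ a ∷ []
      only-a {b} b∈ = here (decidable-stable (b ≟ a) (λ b≢a → none (b , b≢a , ∈-neighbours⁻ b∈)))
      a∈ : a ∷ [] ⊆ neighbours v
      a∈ (here refl) = ∈-neighbours⁺ e

  has-neighbour : Connected (adj G) → 2 ≤ m → ∀ v → ∃ λ a → T (adj G v a)
  has-neighbour connected 2≤m v with missing-element (v ∷ []) 2≤m
  ... | t , t∉[v] with connected v t
  ... | _ , []                = contradiction (here refl) t∉[v]
  ... | _ , (_∷_ {w = a} e _) = a , e

  non-leaf : Connected (adj G) → 3 ≤ m → ∃ λ c → degree G c ≢ 1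
  non-leaf connected 3≤m with fromℕ< (≤-trans (s≤s z≤n) 3≤m)
  ... | v₀ with degree G v₀ ℕ.≟ 1
  ... | no v₀-non-leaf = v₀ , v₀-non-leaf
  ... | yes v₀-leaf with has-neighbour connected (≤-trans (n≤1+n 2) 3≤m) v₀
  ... | v₁ , e with degree G v₁ ℕ.≟ 1
  ...   | no v₁-non-leaf = v₁ , v₁-non-leaf
  ...   | yes v₁-leaf =
          -- two adjacent leaves form a whole component, which misses a third vertex
          let c , c∉ = missing-element (v₀ ∷ v₁ ∷ []) 3≤m
          in ⊥-elim (c∉ (walk-preserves (_∈ v₀ ∷ v₁ ∷ []) closed (proj₂ (connected v₀ c)) (here refl)))
    where
      closed : ∀ {x y} → T (adj G x y) → x ∈ v₀ ∷ v₁ ∷ [] → y ∈ v₀ ∷ v₁ ∷ []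
      closed exy (here refl)         = there (here (degree≡1⇒atMostOneNeighbour v₀-leaf exy e))
      closed exy (there (here refl)) = here (degree≡1⇒atMostOneNeighbour v₁-leaf exy (flip-edge e))

module _ {m} (G : Graph m) (acyclic : ¬ HasCycle (adj G)) where

  open Undirected (adj-sym G)

  no-bypass : ∀ {s a b k} → T (adj G s a) → T (adj G s b) → a ≢ b →
    (w : Walk (adj G) a b k) → s ∉ verts w → ⊥
  no-bypass {s} esa esb a≢b w s∉w with to-path _≟_ w
  ... | j , q , q-unique , q⊆w =
        acyclic (_ , suc (suc j) , flip-edge esb ∷ esa ∷ q , s≤s (s≤s (walk-length-pos a≢b q)) , cycle-unique)
    where
      cycle-unique : Unique (s ∷ tailVerts (esa ∷ q))
      cycle-unique = subst (Unique ∘ (s ∷_)) (verts≡source∷tailVerts q)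
                           (¬Any⇒All¬ (verts q) (s∉w ∘ q⊆w) ∷ q-unique)

  fresh-neighbour : ∀ {c p c′ s k} → T (adj G c p) → T (adj G c c′) → c′ ≢ p →
    (w : Walk (adj G) p s k) → c ∉ verts w → c′ ∉ c ∷ verts w
  fresh-neighbour _ ecc′ _ _ _ (here refl) = no-loop G ecc′
  fresh-neighbour ecp ecc′ c′≢p w c∉w (there c′∈w) =
    let _ , q , q⊆w , _ = prefix w c′∈w
    in no-bypass ecp ecc′ (c′≢p ∘ sym) q (c∉w ∘ q⊆w)

  -- c ∷ w stays a path, so it can be extended at most m times; fuel counts the extensions left.
  extend-to-leaf : ∀ fuel {c p s k} → T (adj G c p) → (w : Walk (adj G) p s k) →
    Unique (verts w) → c ∉ verts w → m ≤ fuel + length (c ∷ verts w) →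
    ∃ λ l → degree G l ≡ 1 × ∃₂ λ j (ρ : Walk (adj G) c l j) → Disjoint (verts ρ) (verts w)
  extend-to-leaf fuel {c} ecp w w-unique c∉w bound with degree G c ℕ.≟ 1
  ... | yes c-leaf = c , c-leaf , 0 , [] , λ { (here refl , c∈w) → c∉w c∈w }
  ... | no c-non-leaf with another-neighbour G ecp c-non-leaf
  ... | c′ , c′≢p , ecc′ with fresh-neighbour ecp ecc′ c′≢p w c∉w
  extend-to-leaf zero ecp w w-unique c∉w bound | no _ | c′ , _ , _ | c′∉c∷w =
    ⊥-elim (<-irrefl refl (≤-trans (Unique⇒length≤ c′∷c∷w-unique) bound))
    where
      c′∷c∷w-unique : Unique (c′ ∷ verts (ecp ∷ w))
      c′∷c∷w-unique = ¬Any⇒All¬ _ c′∉c∷w ∷ ¬Any⇒All¬ _ c∉w ∷ w-unique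
  extend-to-leaf (suc fuel) ecp w w-unique c∉w bound | no _ | c′ , _ , ecc′ | c′∉c∷w =
    let l , l-leaf , j , ρ , ρ#c∷w =
          extend-to-leaf fuel (flip-edge ecc′) (ecp ∷ w) (¬Any⇒All¬ _ c∉w ∷ w-unique) c′∉c∷w
                         (subst (m ≤_) (sym (+-suc fuel _)) bound)
    in l , l-leaf , suc j , ecc′ ∷ ρ , λ where
         (here refl , c∈w)  → c∉w c∈w
         (there x∈ρ , x∈w) → ρ#c∷w (x∈ρ , there x∈w)

  leaf-beyond : ∀ {s a} → T (adj G s a) →
    ∃ λ l → degree G l ≡ 1 × ∃₂ λ k (ρ : Walk (adj G) a l k) → s ∉ verts ρ
  leaf-beyond {s} {a} esa =
    let l , l-leaf , k , ρ , ρ#s = extend-to-leaf m (flip-edge esa) [] ([] ∷ []) a∉[s] (m≤m+n m 2)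
    in l , l-leaf , k , ρ , λ s∈ρ → ρ#s (s∈ρ , here refl)
    where
      a∉[s] : a ∉ s ∷ []
      a∉[s] (here refl) = no-loop G esa

module _ {m} (G : Graph m) (connected : Connected (adj G)) (acyclic : ¬ HasCycle (adj G))
         (2≤m : 2 ≤ m) {S : List (Fin m)} (S-gp : GeneralPosition (adj G) S) where

  open Undirected (adj-sym G)

  Separates : Fin m → Fin m → Set
  Separates s l = ∀ {u} → u ∈ S → u ≢ s → ∀ {k} (w : Walk (adj G) l u k) → s ∈ verts w

  Escapes : Fin m → Fin m → Set
  Escapes s a = ∃ λ u → u ∈ S × u ≢ s × ∃₂ λ k (w : Walk (adj G) a u k) → s ∉ verts w

  separates-injective : ∀ {s t l} → s ∈ S → t ∈ S → Separates s l → Separates t l → s ≡ t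
  separates-injective {s} {t} {l} s∈S t∈S s-separates t-separates with s ≟ t
  ... | yes s≡t = s≡t
  ... | no s≢t  = ⊥-elim (¬¬shortest-walk (proj₂ (connected l t)) λ (_ , q , q-shortest) →
          let _ , q₁ , _ , _     , |q₁|<|q| = prefix q (s-separates t∈S (s≢t ∘ sym) q)
              _ , q₂ , _ , |q₂|≤|q₁| , _  = prefix q₁ (t-separates s∈S s≢t q₁)
          in <⇒≱ (≤-<-trans |q₂|≤|q₁| (|q₁|<|q| s≢t)) (q-shortest q₂))

  ¬escapes⇒separates : ∀ {s a} → ¬ Escapes s a → Separates s a
  ¬escapes⇒separates {s} ¬escapes {u} u∈S u≢s w =
    decidable-stable (Any.any? (s ≟_) (verts w)) (λ s∉w → ¬escapes (u , u∈S , u≢s , _ , w , s∉w))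

  separates-beyond : ∀ {s a l k} → Separates s a → (ρ : Walk (adj G) a l k) → s ∉ verts ρ →
    Separates s l
  separates-beyond a-separated ρ s∉ρ u∈S u≢s w =
    [ ⊥-elim ∘ s∉ρ , id ] (∈-verts-++⁻ ρ w (a-separated u∈S u≢s (ρ ++ᵂ w)))

  ¬¬walk-avoiding : ∀ {s u u′} → s ∈ S → u ∈ S → u′ ∈ S → u ≢ s → u′ ≢ s →
    ¬ ¬ (∃₂ λ k (w : Walk (adj G) u u′ k) → s ∉ verts w)
  ¬¬walk-avoiding {s} {u} {u′} s∈S u∈S u′∈S u≢s u′≢s none with u ≟ u′
  ... | yes refl = none (0 , [] , λ { (here refl) → u≢s refl })
  ... | no u≢u′  = ¬¬shortest-walk (proj₂ (connected u u′)) λ (_ , q , q-shortest) →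
          none (_ , q , λ s∈q → S-gp q q-shortest u s u′ u∈S s∈S u′∈S u≢s (u′≢s ∘ sym) u≢u′
                                   (source∈verts q) s∈q (target∈verts q))

  ¬both-escape : ∀ {s a b} → s ∈ S → T (adj G s a) → T (adj G s b) → a ≢ b →
    Escapes s a → Escapes s b → ⊥
  ¬both-escape s∈S esa esb a≢b (u , u∈S , u≢s , _ , wa , s∉wa) (u′ , u′∈S , u′≢s , _ , wb , s∉wb) =
    ¬¬walk-avoiding s∈S u∈S u′∈S u≢s u′≢s λ (_ , q , s∉q) →
      no-bypass G acyclic esa esb a≢b (wa ++ᵂ q ++ᵂ reverse wb)
        (∉-verts-++ wa _ s∉wa (∉-verts-++ q _ s∉q (s∉wb ∘ ∈-verts-reverse⁻ wb)))

  ¬¬separated-leaf : ∀ {s} → s ∈ S → ¬ ¬ (∃ λ l → l ∈ leaves G × Separates s l)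
  ¬¬separated-leaf {s} s∈S none with degree G s ℕ.≟ 1
  ... | yes s-leaf = none (s , ∈-leaves⁺ G s-leaf , λ _ _ w → source∈verts w)
  ... | no s-non-leaf =
        let a , esa = has-neighbour G connected 2≤m s
            b , b≢a , esb = another-neighbour G esa s-non-leaf
        in ¬¬escapes esa (λ a-escapes → ¬¬escapes esb (¬both-escape s∈S esa esb (b≢a ∘ sym) a-escapes))
    where
      ¬¬escapes : ∀ {a} → T (adj G s a) → ¬ ¬ Escapes s a
      ¬¬escapes esa ¬escapes =
        let l , l-leaf , _ , ρ , s∉ρ = leaf-beyond G acyclic esa
        in none (l , ∈-leaves⁺ G l-leaf , separates-beyond (¬escapes⇒separates ¬escapes) ρ s∉ρ)

  -- ≤ on ℕ is decidable, so it suffices to prove the bound under double negation, where shortest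
  -- walks and a non-escaping side of s can be chosen classically.
  length≤numLeaves : Unique S → length S ≤ numLeaves G
  length≤numLeaves S-unique = decidable-stable (length S ≤? numLeaves G)
    (¬¬-map (λ separated → injection⇒length≤ Separates S-unique separated separates-injective)
            (sequenceM 0ℓ ¬¬-Monad (All.tabulate ¬¬separated-leaf)))

module Sierpiński {n m} (G : Graph n) (f : Fin n → Fin m) (H : Graph m) where

  G⊗H : Adjacency (Fin n × Fin m)
  G⊗H = sierpinski G f H

  G⊗H-sym : ∀ u v → G⊗H u v ≡ G⊗H v u
  G⊗H-sym (g , h) (g′ , h′) =
    cong₂ _∨_ (cong₂ _∧_ (⌊≟⌋-sym _≟_ g g′) (adj-sym H h h′))
              (cong₂ _∧_ (adj-sym G g g′) (∧-comm ⌊ h ≟ f g′ ⌋ ⌊ h′ ≟ f g ⌋))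

  _≟ₚ_ : DecidableEquality (Fin n × Fin m)
  _≟ₚ_ = ≡-dec _≟_ _≟_

  G⊗H-edge⁻ : ∀ {g h g′ h′} → T (G⊗H (g , h) (g′ , h′)) →
    (g ≡ g′ × T (adj H h h′)) ⊎ (T (adj G g g′) × h ≡ f g′ × h′ ≡ f g)
  G⊗H-edge⁻ {g} {h} {g′} {h′} e with Equivalence.to (T-∨ {⌊ g ≟ g′ ⌋ ∧ adj H h h′}) e
  ... | inj₁ in-layer =
        let g≡g′ , ehh′ = Equivalence.to (T-∧ {⌊ g ≟ g′ ⌋}) in-layer
        in inj₁ (toWitness g≡g′ , ehh′)
  ... | inj₂ jump =
        let egg′ , ends = Equivalence.to (T-∧ {adj G g g′}) jump
            h≡fg′ , h′≡fg = Equivalence.to (T-∧ {⌊ h ≟ f g′ ⌋}) ends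
        in inj₂ (egg′ , toWitness h≡fg′ , toWitness h′≡fg)

  layer-edge : ∀ {g h h′} → T (adj H h h′) → T (G⊗H (g , h) (g , h′))
  layer-edge {g} ehh′ =
    Equivalence.from T-∨ (inj₁ (Equivalence.from T-∧ (fromWitness {a? = g ≟ g} refl , ehh′)))

  lift : ∀ g {h h′ k} → Walk (adj H) h h′ k → Walk G⊗H (g , h) (g , h′) k
  lift g []      = []
  lift g (e ∷ p) = layer-edge e ∷ lift g p

  ∈-verts-lift⁺ : ∀ g {h h′ k x} (p : Walk (adj H) h h′ k) → x ∈ verts p →
    (g , x) ∈ verts (lift g p)
  ∈-verts-lift⁺ g []      (here refl) = here refl
  ∈-verts-lift⁺ g (_ ∷ _) (here refl) = here refl
  ∈-verts-lift⁺ g (_ ∷ p) (there x∈p) = there (∈-verts-lift⁺ g p x∈p)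

  TwoWalks : Fin m → Fin m → Fin m → Fin m → ℕ → Set
  TwoWalks u v u′ v′ k = ∃₂ λ a b → a + b ≤ k × Walk (adj H) u v a × Walk (adj H) u′ v′ b

  weaken : ∀ {u v u′ v′ k} → TwoWalks u v u′ v′ k → TwoWalks u v u′ v′ (suc k)
  weaken (a , b , a+b≤k , p , q) = a , b , m≤n⇒m≤1+n a+b≤k , p , q

  -- A jump (x, f x′) — (x′, f x) between layers exchanges the two alternatives.
  projection : ∀ {x y g h′ k} → Walk G⊗H (x , y) (g , h′) k →
    TwoWalks y h′ (f x) (f g) k ⊎ TwoWalks (f x) h′ y (f g) k
  projection [] = inj₁ (0 , 0 , z≤n , [] , [])
  projection {k = suc k} (e ∷ p) with G⊗H-edge⁻ e | projection p
  ... | inj₁ (refl , e′) | inj₁ (a , b , a+b≤k , q , r) = inj₁ (suc a , b , s≤s a+b≤k , e′ ∷ q , r)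
  ... | inj₁ (refl , e′) | inj₂ (a , b , a+b≤k , q , r) =
        inj₂ (a , suc b , subst (_≤ suc k) (sym (+-suc a b)) (s≤s a+b≤k) , q , e′ ∷ r)
  ... | inj₂ (_ , refl , refl) | walks = swap (⊎-map weaken weaken walks)

  walk-in-layer : ∀ {g h h′ k} → Walk G⊗H (g , h) (g , h′) k →
    ∃ λ j → j ≤ k × Walk (adj H) h h′ j
  walk-in-layer {k = k} p with projection p
  ... | inj₁ (a , b , a+b≤k , q , _) = a , ≤-trans (m≤m+n a b) a+b≤k , q
  ... | inj₂ (a , b , a+b≤k , q , r) = b + a , subst (_≤ k) (+-comm a b) a+b≤k , r ++ᵂ q

  lift-shortest : ∀ g {h h′ k} (p : Walk (adj H) h h′ k) → IsShortest p → IsShortest (lift g p)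
  lift-shortest g p p-shortest w = let _ , j≤k , q = walk-in-layer w in ≤-trans (p-shortest q) j≤k

  layer : List (Fin n × Fin m) → Fin n → List (Fin m)
  layer X g = filter (λ h → Any.any? ((g , h) ≟ₚ_) X) (allFin m)

  ∈-layer⁺ : ∀ {X g h} → (g , h) ∈ X → h ∈ layer X g
  ∈-layer⁺ {X} {g} {h} = ∈-filter⁺ (λ h → Any.any? ((g , h) ≟ₚ_) X) (∈-allFin h)

  ∈-layer⁻ : ∀ {X g h} → h ∈ layer X g → (g , h) ∈ X
  ∈-layer⁻ {X} {g} = proj₂ ∘ ∈-filter⁻ (λ h → Any.any? ((g , h) ≟ₚ_) X) {xs = allFin m}

  layer-unique : ∀ X g → Unique (layer X g)
  layer-unique X g = Unique.filter⁺ (λ h → Any.any? ((g , h) ≟ₚ_) X) (Unique.allFin⁺ m)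

  layer-generalPosition : ∀ {X} → GeneralPosition G⊗H X → ∀ g →
    GeneralPosition (adj H) (layer X g)
  layer-generalPosition {X} X-gp g p p-shortest x y z x∈ y∈ z∈ x≢y y≢z x≢z x∈p y∈p z∈p =
    X-gp (lift g p) (lift-shortest g p p-shortest) (g , x) (g , y) (g , z)
         (∈-layer⁻ {X} x∈) (∈-layer⁻ {X} y∈) (∈-layer⁻ {X} z∈)
         (x≢y ∘ cong proj₂) (y≢z ∘ cong proj₂) (x≢z ∘ cong proj₂)
         (∈-verts-lift⁺ g p x∈p) (∈-verts-lift⁺ g p y∈p) (∈-verts-lift⁺ g p z∈p)

  ⊆-layers : ∀ X → X ⊆ concatMap (λ g → map (g ,_) (layer X g)) (allFin n)
  ⊆-layers X {g , h} x∈X = ∈-concatMap⁺ _ (lose (∈-allFin g) (∈-map⁺ (g ,_) (∈-layer⁺ x∈X)))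

  length≤n*numLeaves : IsTree H → 2 ≤ m → ∀ X → IsGPSet G⊗H X → length X ≤ n * numLeaves H
  length≤n*numLeaves (H-connected , H-acyclic) 2≤m X (X-unique , X-gp) = begin
    length X
      ≤⟨ ⊆⇒length≤ X-unique (⊆-layers X) ⟩
    length (concatMap (λ g → map (g ,_) (layer X g)) (allFin n))
      ≤⟨ length-concatMap≤ _ (allFin n) layer-bound ⟩
    length (allFin n) * numLeaves H
      ≡⟨ cong (_* numLeaves H) (length-allFin n) ⟩
    n * numLeaves H
      ∎
    where
      open ≤-Reasoning
      layer-bound : ∀ g → length (map (g ,_) (layer X g)) ≤ numLeaves H
      layer-bound g = subst (_≤ numLeaves H) (sym (length-map (g ,_) (layer X g)))
        (length≤numLeaves H H-connected H-acyclic 2≤m (layer-generalPosition X-gp g) (layer-unique X g))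

  leaf-outside-image⇒atMostOneNeighbour : ∀ {g h} → degree H h ≡ 1 → (∀ g′ → h ≢ f g′) →
    AtMostOneNeighbour G⊗H (g , h)
  leaf-outside-image⇒atMostOneNeighbour h-leaf outside e₁ e₂ with G⊗H-edge⁻ e₁ | G⊗H-edge⁻ e₂
  ... | inj₁ (refl , e₁′)    | inj₁ (refl , e₂′)    = cong (_ ,_) (degree≡1⇒atMostOneNeighbour H h-leaf e₁′ e₂′)
  ... | inj₂ (_ , h≡fg′ , _) | _                    = contradiction h≡fg′ (outside _)
  ... | inj₁ _               | inj₂ (_ , h≡fg′ , _) = contradiction h≡fg′ (outside _)

  leaf-layers : List (Fin n × Fin m)
  leaf-layers = cartesianProduct (allFin n) (leaves H)

  leaf-layers-gp : (∀ g → degree H (f g) ≢ 1) → IsGPSet G⊗H leaf-layers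
  leaf-layers-gp image-non-leaf =
    Unique.cartesianProduct⁺ (Unique.allFin⁺ n) (leaves-unique H) ,
    Undirected.atMostOneNeighbour⇒generalPosition G⊗H-sym _≟ₚ_ lone
    where
      lone : ∀ {x} → x ∈ leaf-layers → AtMostOneNeighbour G⊗H x
      lone {g , h} x∈ = leaf-outside-image⇒atMostOneNeighbour h-leaf outside
        where
          h-leaf : degree H h ≡ 1
          h-leaf = ∈-leaves⁻ H (proj₂ (∈-cartesianProduct⁻ (allFin n) (leaves H) x∈))
          outside : ∀ g′ → h ≢ f g′
          outside g′ refl = image-non-leaf g′ h-leaf

  length-leaf-layers : length leaf-layers ≡ n * numLeaves H
  length-leaf-layers =
    trans (length-cartesianProduct (allFin n) (leaves H)) (cong (_* numLeaves H) (length-allFin n))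

corollary4p3 : ∀ {n m} (G : Graph n) (T : Graph m) →
    Connected (adj G) → 2 ≤ n → IsTree T → 3 ≤ m →
    IsGPS G T (n * numLeaves T)
corollary4p3 {n} G H _ _ H-tree 3≤m with non-leaf H (proj₁ H-tree) 3≤m
... | c , c-non-leaf =
  (const c , attained , upper (const c)) , λ { f _ ((X , X-gp , refl) , _) → upper f X X-gp }
  where
    open Sierpiński G (const c) H using (leaf-layers; leaf-layers-gp; length-leaf-layers)

    upper : ∀ f X → IsGPSet (sierpinski G f H) X → length X ≤ n * numLeaves H
    upper f = Sierpiński.length≤n*numLeaves G f H H-tree (≤-trans (n≤1+n 2) 3≤m)

    attained : ∃ λ X → IsGPSet (sierpinski G (const c) H) X × length X ≡ n * numLeaves H
    attained = leaf-layers , leaf-layers-gp (λ _ → c-non-leaf) , length-leaf-layers
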